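{- Let $\mathcal{D}$ be the arena of a playable $p$-periodic temporal graph $\mathcal{G}$, let $\mathcal{A}$ be an augmented arena of $\mathcal{D}$, let $t\in\mathbb{Z}_p$, $x,y\in V$, and $z\in\Gamma_t(x,\mathcal{D})$. If $(t,y)$ is a shadow corner of $(t+1,z)$ with respect to $\mathcal{A}$, then the arena $\mathcal{A}'$ obtained from $\mathcal{A}$ by adding the edge $((t,x),(t+1,y))$ is an augmented arena of $\mathcal{D}$.
   Context: Let $V$ be a finite set of $n$ vertices and $p\ge 1$ an integer. A $p$-periodic temporal graph $\mathcal{G}=(G_0,\dots,G_{p-1})^*$ is the infinite sequence of directed graphs whose snapshot at time $t\in\{0,1,2,\dots\}$ is $G_{t\bmod p}=(V,E_{t\bmod p})$, where each $E_i\subseteq V\times V$ may contain self-loops. It is playable if in every $G_i$ every vertex has at least one outgoing edge; no other assumption is made. Slice indices are taken modulo $p$. An arena of length $p$ on $V$ is a directed graph with vertex set $\mathbb{Z}_p\times V$ (temporal nodes) all of whose edges have the form $((i,w),(i+1 \bmod p,w'))$. The arena of $\mathcal{G}$ is the arena $\mathcal{D}$ with $((i,u),(i+1,v))\in E(\mathcal{D})$ iff $(u,v)\in E_i$. For an arena $\mathcal{A}$ write $\Gamma_t(u,\mathcal{A})=\{v\in V:((t,u),(t+1,v))\in E(\mathcal{A})\}$. Game (one cop, one robber, restless, full information): in each round $t$, first the cop moves from its vertex $c$ to some $c'\in\Gamma_{t\bmod p}(c,\mathcal{D})$, then the robber moves from its vertex $r$ to some $r'\in\Gamma_{t\bmod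 p}(r,\mathcal{D})$. The cop wins if it moves onto the vertex currently occupied by the robber (both on the same vertex counts as capture); the robber wins by avoiding capture forever. A configuration $(t,c,r)$ (cop at $c$, robber at $r$ at the start of round $t$, cop to move) is copwin if the cop has a strategy guaranteeing capture from it; this depends only on $t\bmod p$. An augmented arena of $\mathcal{D}$ is an arena $\mathcal{A}$ with $E(\mathcal{D})\subseteq E(\mathcal{A})$ such that for every edge $((t,x),(t+1,y))\in E(\mathcal{A})$ the configuration $(t,x,y)$ is copwin. Given an augmented arena $\mathcal{A}$, a temporal node $(t,u)$ is a shadow corner of the temporal node $(t+1,v)$ (and $(t+1,v)$ a shadow cover of $(t,u)$) if $v\neq u$ and $\Gamma_t(u,\mathcal{D})\subseteq\Gamma_{t+1}(v,\mathcal{A})$. -}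

module Defs where

open import Data.Nat using (ℕ; suc; _%_)
open import Data.Nat.DivMod using (m%n<n)
open import Data.Fin using (Fin; toℕ; fromℕ<)
open import Data.Product using (∃; _×_)
open import Data.Sum using (_⊎_)
open import Relation.Binary.PropositionalEquality using (_≡_; _≢_)

next : ∀ {p} → Fin p → Fin p
next {ℕ.suc m} i = fromℕ< (m%n<n (ℕ.suc (toℕ i)) (ℕ.suc m))

-- An arena of length p on V = Fin n: Ar i w w' means the edge ((i,w),(i+1 mod p,w')).
Arena : ℕ → ℕ → Set₁
Arena p n = Fin p → Fin n → Fin n → Set

TemporalGraph : ℕ → ℕ → Set₁
TemporalGraph p n = Fin p → Fin n → Fin n → Set

Playable : ∀ {p n} → TemporalGraph p n → Set
Playable {p} {n} E = (i : Fin p) (u : Fin n) → ∃ λ v → E i u v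

arenaOf : ∀ {p n} → TemporalGraph p n → Arena p n
arenaOf E i u v = E i u v

_⊆A_ : ∀ {p n} → Arena p n → Arena p n → Set
_⊆A_ {p} {n} D A = (i : Fin p) (u v : Fin n) → D i u v → A i u v

-- Cop-win configurations (t, c, r) of the game played on arena D:
-- least fixed point (cop has a strategy guaranteeing capture).
-- Capture: cop and robber on the same vertex (either the cop moves onto the
-- robber, or the robber moves onto the cop, or they start together).
data CopWin {p n} (D : Arena p n) : Fin p → Fin n → Fin n → Set where
  caught : ∀ {t c r} → c ≡ r → CopWin D t c r
  move   : ∀ {t c r} (c' : Fin n) → D t c c' →
           (c' ≡ r ⊎ ((r' : Fin n) → D t r r' → CopWin D (next t) c' r')) →
           CopWin D t c r

Augmented : ∀ {p n} → Arena p n → Arena p n → Set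
Augmented {p} {n} D A =
  (D ⊆A A) × ((t : Fin p) (x y : Fin n) → A t x y → CopWin D t x y)

ShadowCorner : ∀ {p n} → Arena p n → Arena p n → Fin p → Fin n → Fin n → Set
ShadowCorner {p} {n} D A t u v =
  (v ≢ u) × ((w : Fin n) → D t u w → A (next t) v w)

addEdge : ∀ {p n} → Arena p n → Fin p → Fin n → Fin n → Arena p n
addEdge A t x y t' a b = A t' a b ⊎ ((t' ≡ t) × (a ≡ x) × (b ≡ y))

module Submission where

open import Defs
open import Data.Nat using (ℕ)
open import Data.Fin using (Fin)
open import Data.Product using (_,_)
open import Data.Sum using (inj₁; inj₂)
open import Relation.Binary.PropositionalEquality using (refl)

-- The cop plays x → z; every reply y → w of the robber stays inside Γ_t(y, D) ⊆ Γ_{t+1}(z, A),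
-- so the next configuration (t+1, z, w) is an edge of A and hence copwin.

CopWinEdges : ∀ {p n} → Arena p n → Arena p n → Set
CopWinEdges {p} {n} D A = (t : Fin p) (x y : Fin n) → A t x y → CopWin D t x y

copWin-step-into : ∀ {p n} {D A : Arena p n} → CopWinEdges D A →
  (t : Fin p) (c r c' : Fin n) → D t c c' →
  ((r' : Fin n) → D t r r' → A (next t) c' r') →
  CopWin D t c r
copWin-step-into win t c r c' dcc' cover =
  move c' dcc' (inj₂ (λ r' drr' → win (next t) c' r' (cover r' drr')))

augmented-addEdge : ∀ {p n} {D A : Arena p n} → Augmented D A →
  (t : Fin p) (x y : Fin n) → CopWin D t x y →
  Augmented D (addEdge A t x y)
augmented-addEdge {D = D} {A} (D⊆A , win) t x y winxy =
  (λ i u v d → inj₁ (D⊆A i u v d)) , win′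
  where
  win′ : CopWinEdges D (addEdge A t x y)
  win′ t′ a b (inj₁ e)                      = win t′ a b e
  win′ .t .x .y (inj₂ (refl , refl , refl)) = winxy

theorem2 : (p n : ℕ) (E : TemporalGraph p n) → Playable E →
    (A : Arena p n) → Augmented (arenaOf E) A →
    (t : Fin p) (x y z : Fin n) → arenaOf E t x z →
    ShadowCorner (arenaOf E) A t y z →
    Augmented (arenaOf E) (addEdge A t x y)
theorem2 p n E _ A aug@(_ , win) t x y z exz (_ , shadow) =
  augmented-addEdge aug t x y (copWin-step-into win t x y z exz shadow)
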